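{- Let $\pi$ be a projectivity of $\mathrm{PG}(1,E)$ with $\mathrm{PG}(1,F)^\pi=\mathrm{PG}(1,F)$. Then for every point $T\in\mathrm{PG}(1,E)$ we have $L_{T^\pi}=(L_T)^\pi$ and $L'_{T^\pi}=(L'_T)^\pi$.
   Context: Let $q$ be a prime power, $t\ge 2$, and $E=\mathrm{End}_{\mathbb{F}_q}(\mathbb{F}_{q^t})$, the ring of $\mathbb{F}_q$-linear maps $\mathbb{F}_{q^t}\to\mathbb{F}_{q^t}$, maps written on the right and composed left to right; $E^*$ is its unit group. For $a\in\mathbb{F}_{q^t}$ let $\rho_a\in E$ be $x\mapsto ax$. $E^2$ is a left $E$-module of row vectors with $\mathrm{GL}_2(E)$ acting from the right. A pair $(\alpha,\beta)\in E^2$ is admissible if it is the first row of a matrix in $\mathrm{GL}_2(E)$. The projective line $\mathrm{PG}(1,E)$ is the set of cyclic submodules $E(\alpha,\beta)$ with $(\alpha,\beta)$ admissible (points); $E(\alpha,\beta)=E(\alpha',\beta')$ iff $(\alpha',\beta')=(\gamma\alpha,\gamma\beta)$ for some $\gamma\in E^*$. Two points $E(\alpha,\beta),E(\gamma,\delta)$ are distant if the matrix with rows $(\alpha,\beta)$, $(\gamma,\delta)$ lies in $\mathrm{GL}_2(E)$, non-distant otherwise. A projectivity of $\mathrm{PG}(1,E)$ is a map $E(\alpha,\beta)\mapsto E((\alpha,\beta)M)$ for a fixed $M\in\mathrm{GL}_2(E)$; images are written exponentially, $T^\pi$. $\mathrm{PG}(1,F)$ denotes $\{E(\rho_a,\rho_b):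 (a,b)\in\mathbb{F}_{q^t}^2\setminus\{(0,0)\}\}$. For a point $T$, $L_T$ is the set of points of $\mathrm{PG}(1,F)$ non-distant to $T$; for $T=E(\alpha,\beta)$ and $h\in\mathbb{F}_{q^t}^*$, $Th=E(\alpha\rho_h,\beta\rho_h)$, and $L'_T=\{Th: h\in\mathbb{F}_{q^t}^*\}$. -}

module Defs where

open import Level using (0ℓ)
open import Data.Nat using (ℕ; zero; suc; _≤_) renaming (_^_ to _^ℕ_)
open import Data.Nat.Primality using (Prime)
open import Data.Fin using (Fin)
open import Data.Product using (Σ; ∃; _×_; _,_; proj₁; proj₂)
open import Function.Bundles using (_↔_)
open import Relation.Binary.PropositionalEquality using (_≡_; _≢_)
open import Relation.Nullary using (¬_)
open import Algebra.Structures using (IsCommutativeRing)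

IsPrimePower : ℕ → Set
IsPrimePower q = Σ ℕ λ p → Σ ℕ λ k → Prime p × 1 ≤ k × q ≡ p ^ℕ k

record FiniteField : Set₁ where
  infixl 7 _*_
  infixl 6 _+_
  field
    Carrier : Set
    _+_ _*_ : Carrier → Carrier → Carrier
    -_ : Carrier → Carrier
    0# 1# : Carrier
    isCommutativeRing : IsCommutativeRing _≡_ _+_ _*_ -_ 0# 1#
    0≢1 : 0# ≢ 1#
    inverse : ∀ x → x ≢ 0# → Σ Carrier λ y → x * y ≡ 1#
    size : ℕ
    enum : Fin size ↔ Carrier

-- Everything below is relative to a field K playing the role of F_{q^t},
-- with F_q = { c ∈ K : c ^ q = c } (fixed field of the q-Frobenius).
module Proj (K : FiniteField) (q : ℕ) where
  open FiniteField K

  pow : Carrier → ℕ → Carrier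
  pow x zero = 1#
  pow x (suc n) = x * pow x n

  InFq : Carrier → Set
  InFq c = pow c q ≡ c

  -- raw maps K → K; elements of E are those that are F_q-linear
  Fn : Set
  Fn = Carrier → Carrier

  IsEnd : Fn → Set
  IsEnd f = (∀ x y → f (x + y) ≡ f x + f y) × (∀ c x → InFq c → f (c * x) ≡ c * f x)

  _≈_ : Fn → Fn → Set
  f ≈ g = ∀ x → f x ≡ g x

  -- product in E: maps written on the right, composed left to right:
  -- x (α · β) = (x α) β
  _·_ : Fn → Fn → Fn
  (α · β) x = β (α x)

  _⊕_ : Fn → Fn → Fn
  (α ⊕ β) x = α x + β x

  idE zeroE : Fn
  idE x = x
  zeroE x = 0#

  ρ : Carrier → Fn
  ρ a x = a * x

  IsUnit : Fn → Set
  IsUnit γ = IsEnd γ × Σ Fn λ δ → IsEnd δ × (γ · δ) ≈ idE × (δ · γ) ≈ idE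

  record Pair : Set where
    constructor ⟨_,_⟩
    field fst snd : Fn
  open Pair public

  record Mat : Set where
    constructor mat
    field m11 m12 m21 m22 : Fn
  open Mat public

  _≈P_ : Pair → Pair → Set
  P ≈P Q = fst P ≈ fst Q × snd P ≈ snd Q

  _≈M_ : Mat → Mat → Set
  M ≈M N = m11 M ≈ m11 N × m12 M ≈ m12 N × m21 M ≈ m21 N × m22 M ≈ m22 N

  _⊗_ : Mat → Mat → Mat
  M ⊗ N = mat ((m11 M · m11 N) ⊕ (m12 M · m21 N)) ((m11 M · m12 N) ⊕ (m12 M · m22 N))
              ((m21 M · m11 N) ⊕ (m22 M · m21 N)) ((m21 M · m12 N) ⊕ (m22 M · m22 N))

  I₂ : Mat
  I₂ = mat idE zeroE zeroE idE

  EntriesInE : Mat → Set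
  EntriesInE M = IsEnd (m11 M) × IsEnd (m12 M) × IsEnd (m21 M) × IsEnd (m22 M)

  IsGL : Mat → Set
  IsGL M = EntriesInE M × Σ Mat λ N → EntriesInE N × (M ⊗ N) ≈M I₂ × (N ⊗ M) ≈M I₂

  _▸_ : Pair → Mat → Pair
  P ▸ M = ⟨ (fst P · m11 M) ⊕ (snd P · m21 M) , (fst P · m12 M) ⊕ (snd P · m22 M) ⟩

  rows : Pair → Pair → Mat
  rows P Q = mat (fst P) (snd P) (fst Q) (snd Q)

  Admissible : Pair → Set
  Admissible P = Σ Mat λ M → IsGL M × ⟨ m11 M , m12 M ⟩ ≈P P

  -- E P' = E P  iff  P' = (γ α, γ β) for a unit γ, where P = (α, β)
  _∼_ : Pair → Pair → Set
  P' ∼ P = Σ Fn λ γ → IsUnit γ × P' ≈P ⟨ γ · fst P , γ · snd P ⟩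

  Distant : Pair → Pair → Set
  Distant P Q = IsGL (rows P Q)

  -- subsets of PG(1,E), given as predicates on representatives
  PSet : Set₁
  PSet = Pair → Set

  _≐_ : PSet → PSet → Set
  A ≐ B = ∀ P → Admissible P → (A P → B P) × (B P → A P)

  image : Mat → PSet → PSet
  image M S P = Σ Pair λ Q → Admissible Q × S Q × P ∼ (Q ▸ M)

  PGF : PSet
  PGF P = Σ Carrier λ a → Σ Carrier λ b → ¬ (a ≡ 0# × b ≡ 0#) × P ∼ ⟨ ρ a , ρ b ⟩

  L : Pair → PSet
  L T P = PGF P × ¬ Distant P T

  -- T h = E(α ρ_h, β ρ_h)
  scale : Pair → Carrier → Pair
  scale T h = ⟨ fst T · ρ h , snd T · ρ h ⟩

  L′ : Pair → PSet
  L′ T P = Σ Carrier λ h → h ≢ 0# × P ∼ scale T h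

-- A projectivity π with matrix M maps the point P to P ▸ M, so for a point set S
-- closed under change of representative, P lies in S^π iff P ▸ M⁻¹ lies in S.
-- Both statements thus reduce to a comparison at P ▸ M⁻¹.  For L this is the
-- invariance of distance under GL₂(E) together with PG(1,F)^π = PG(1,F).  For L′
-- the point is that right multiplication by h is the projectivity of the scalar
-- matrix diag(ρ_h, ρ_h), and its conjugate by M fixes every point of PG(1,F)
-- (F is commutative), hence fixes (1,0) and all (a,1); such a matrix is itself
-- scalar, diag(ρ_c, ρ_c) with c ≠ 0, so M moves T h to T^π c.

module Submission where

open import Defs
open import Level using (0ℓ)
open import Data.Nat using (ℕ; _≤_; _^_)
open import Data.Product using (_×_; _,_; proj₁; proj₂; Σ)
open import Function.Bundles using (_⇔_; mk⇔; module Equivalence)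
open import Function.Construct.Composition using (_⇔-∘_)
open import Function.Construct.Symmetry using (⇔-sym)
open import Relation.Binary.Bundles using (Setoid)
open import Relation.Binary.PropositionalEquality
open import Algebra.Bundles using (CommutativeRing)
open import Algebra.Structures using (IsCommutativeRing)
import Algebra.Properties.CommutativeSemigroup as CommutativeSemigroupProperties
import Algebra.Properties.Group as GroupProperties
import Relation.Binary.Reasoning.Setoid as SetoidReasoning

module Projective (K : FiniteField) (q : ℕ) where
  open FiniteField K
  open Proj K q
  open IsCommutativeRing isCommutativeRing
    using (+-identityˡ; +-identityʳ; *-identityˡ; *-identityʳ; *-comm; *-assoc;
           distribˡ; distribʳ; zeroˡ; zeroʳ; -‿inverseʳ)

  commutativeRing : CommutativeRing 0ℓ 0ℓ
  commutativeRing = record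
    { Carrier = Carrier ; _≈_ = _≡_ ; _+_ = _+_ ; _*_ = _*_ ; -_ = -_
    ; 0# = 0# ; 1# = 1# ; isCommutativeRing = isCommutativeRing }

  open CommutativeRing commutativeRing
    using (+-group; +-commutativeSemigroup; *-commutativeSemigroup)

  +-interchange : ∀ u v w z → (u + v) + (w + z) ≡ (u + w) + (v + z)
  +-interchange = CommutativeSemigroupProperties.interchange +-commutativeSemigroup

  *-leftSwap : ∀ x y z → x * (y * z) ≡ y * (x * z)
  *-leftSwap = CommutativeSemigroupProperties.x∙yz≈y∙xz *-commutativeSemigroup

  Additive : Fn → Set
  Additive f = ∀ x y → f (x + y) ≡ f x + f y

  additive⇒0↦0 : ∀ {f} → Additive f → f 0# ≡ 0#
  additive⇒0↦0 {f} add = GroupProperties.identityʳ-unique +-group (f 0#) (f 0#)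
    (trans (sym (add 0# 0#)) (cong f (+-identityʳ 0#)))

  additive⇒0*↦0 : ∀ {f} → Additive f → ∀ x → f (0# * x) ≡ 0#
  additive⇒0*↦0 {f} add x = trans (cong f (zeroˡ x)) (additive⇒0↦0 add)

  ≈-refl : ∀ {f} → f ≈ f
  ≈-refl _ = refl

  ≈-sym : ∀ {f g} → f ≈ g → g ≈ f
  ≈-sym e x = sym (e x)

  ≈-trans : ∀ {f g h} → f ≈ g → g ≈ h → f ≈ h
  ≈-trans e e′ x = trans (e x) (e′ x)

  Pair-setoid : Setoid 0ℓ 0ℓ
  Pair-setoid = record
    { Carrier = Pair ; _≈_ = _≈P_
    ; isEquivalence = record
      { refl = ≈-refl , ≈-refl
      ; sym = λ (e₁ , e₂) → ≈-sym e₁ , ≈-sym e₂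
      ; trans = λ (e₁ , e₂) (e₁′ , e₂′) → ≈-trans e₁ e₁′ , ≈-trans e₂ e₂′ } }

  Mat-setoid : Setoid 0ℓ 0ℓ
  Mat-setoid = record
    { Carrier = Mat ; _≈_ = _≈M_
    ; isEquivalence = record
      { refl = ≈-refl , ≈-refl , ≈-refl , ≈-refl
      ; sym = λ (e₁ , e₂ , e₃ , e₄) → ≈-sym e₁ , ≈-sym e₂ , ≈-sym e₃ , ≈-sym e₄
      ; trans = λ (e₁ , e₂ , e₃ , e₄) (e₁′ , e₂′ , e₃′ , e₄′) →
          ≈-trans e₁ e₁′ , ≈-trans e₂ e₂′ , ≈-trans e₃ e₃′ , ≈-trans e₄ e₄′ } }

  open Setoid Pair-setoid using () renaming (refl to ≈P-refl; sym to ≈P-sym; trans to ≈P-trans)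
  open Setoid Mat-setoid using () renaming (refl to ≈M-refl; sym to ≈M-sym; trans to ≈M-trans)

  ·⊕·-cong : ∀ {f f′ g g′ h h′ k k′} → f ≈ f′ → g ≈ g′ → h ≈ h′ → k ≈ k′ →
    ((f · g) ⊕ (h · k)) ≈ ((f′ · g′) ⊕ (h′ · k′))
  ·⊕·-cong {g′ = g′} {k′ = k′} ef eg eh ek x =
    cong₂ _+_ (trans (eg _) (cong g′ (ef x))) (trans (ek _) (cong k′ (eh x)))

  ⊗-cong : ∀ {A A′ B B′} → A ≈M A′ → B ≈M B′ → (A ⊗ B) ≈M (A′ ⊗ B′)
  ⊗-cong (a₁₁ , a₁₂ , a₂₁ , a₂₂) (b₁₁ , b₁₂ , b₂₁ , b₂₂) =
    ·⊕·-cong a₁₁ b₁₁ a₁₂ b₂₁ , ·⊕·-cong a₁₁ b₁₂ a₁₂ b₂₂ ,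
    ·⊕·-cong a₂₁ b₁₁ a₂₂ b₂₁ , ·⊕·-cong a₂₁ b₁₂ a₂₂ b₂₂

  ▸-cong : ∀ {P P′ A A′} → P ≈P P′ → A ≈M A′ → (P ▸ A) ≈P (P′ ▸ A′)
  ▸-cong (p₁ , p₂) (b₁₁ , b₁₂ , b₂₁ , b₂₂) = ·⊕·-cong p₁ b₁₁ p₂ b₂₁ , ·⊕·-cong p₁ b₁₂ p₂ b₂₂

  entry-assoc : ∀ a₁ a₂ b₁₁ b₁₂ b₂₁ b₂₂ c₁ c₂ → Additive c₁ → Additive c₂ →
    ((((a₁ · b₁₁) ⊕ (a₂ · b₂₁)) · c₁) ⊕ (((a₁ · b₁₂) ⊕ (a₂ · b₂₂)) · c₂))
      ≈ ((a₁ · ((b₁₁ · c₁) ⊕ (b₁₂ · c₂))) ⊕ (a₂ · ((b₂₁ · c₁) ⊕ (b₂₂ · c₂))))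
  entry-assoc _ _ _ _ _ _ _ _ add₁ add₂ x =
    trans (cong₂ _+_ (add₁ _ _) (add₂ _ _)) (+-interchange _ _ _ _)

  ⊗-assoc : ∀ A B {C} → EntriesInE C → ((A ⊗ B) ⊗ C) ≈M (A ⊗ (B ⊗ C))
  ⊗-assoc (mat a₁₁ a₁₂ a₂₁ a₂₂) (mat b₁₁ b₁₂ b₂₁ b₂₂) {mat c₁₁ c₁₂ c₂₁ c₂₂}
          ((add₁₁ , _) , (add₁₂ , _) , (add₂₁ , _) , (add₂₂ , _)) =
    entry-assoc a₁₁ a₁₂ b₁₁ b₁₂ b₂₁ b₂₂ c₁₁ c₂₁ add₁₁ add₂₁ ,
    entry-assoc a₁₁ a₁₂ b₁₁ b₁₂ b₂₁ b₂₂ c₁₂ c₂₂ add₁₂ add₂₂ ,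
    entry-assoc a₂₁ a₂₂ b₁₁ b₁₂ b₂₁ b₂₂ c₁₁ c₂₁ add₁₁ add₂₁ ,
    entry-assoc a₂₁ a₂₂ b₁₁ b₁₂ b₂₁ b₂₂ c₁₂ c₂₂ add₁₂ add₂₂

  ▸-assoc : ∀ P A {B} → EntriesInE B → ((P ▸ A) ▸ B) ≈P (P ▸ (A ⊗ B))
  ▸-assoc ⟨ p₁ , p₂ ⟩ (mat a₁₁ a₁₂ a₂₁ a₂₂) {mat b₁₁ b₁₂ b₂₁ b₂₂}
          ((add₁₁ , _) , (add₁₂ , _) , (add₂₁ , _) , (add₂₂ , _)) =
    entry-assoc p₁ p₂ a₁₁ a₁₂ a₂₁ a₂₂ b₁₁ b₂₁ add₁₁ add₂₁ ,
    entry-assoc p₁ p₂ a₁₁ a₁₂ a₂₁ a₂₂ b₁₂ b₂₂ add₁₂ add₂₂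

  ▸-assoc₃ : ∀ P A {B C} → EntriesInE B → EntriesInE C →
    (((P ▸ A) ▸ B) ▸ C) ≈P (P ▸ ((A ⊗ B) ⊗ C))
  ▸-assoc₃ P A {B} {C} eB eC =
    ≈P-trans (▸-cong (▸-assoc P A eB) (≈M-refl {C})) (▸-assoc P (A ⊗ B) eC)

  ⊗-identityʳ : ∀ A → (A ⊗ I₂) ≈M A
  ⊗-identityʳ _ = (λ _ → +-identityʳ _) , (λ _ → +-identityˡ _) ,
                  (λ _ → +-identityʳ _) , (λ _ → +-identityˡ _)

  ⊗-identityˡ : ∀ {A} → EntriesInE A → (I₂ ⊗ A) ≈M A
  ⊗-identityˡ ((add₁₁ , _) , (add₁₂ , _) , (add₂₁ , _) , (add₂₂ , _)) =
    (λ _ → trans (cong (_ +_) (additive⇒0↦0 add₂₁)) (+-identityʳ _)) ,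
    (λ _ → trans (cong (_ +_) (additive⇒0↦0 add₂₂)) (+-identityʳ _)) ,
    (λ _ → trans (cong (_+ _) (additive⇒0↦0 add₁₁)) (+-identityˡ _)) ,
    (λ _ → trans (cong (_+ _) (additive⇒0↦0 add₁₂)) (+-identityˡ _))

  ▸-identityʳ : ∀ P → (P ▸ I₂) ≈P P
  ▸-identityʳ _ = (λ _ → +-identityʳ _) , (λ _ → +-identityˡ _)

  IsEnd-resp : ∀ {f g} → f ≈ g → IsEnd f → IsEnd g
  IsEnd-resp e (add , lin) =
    (λ x y → trans (sym (e (x + y))) (trans (add x y) (cong₂ _+_ (e x) (e y)))) ,
    (λ c x c∈Fq → trans (sym (e (c * x))) (trans (lin c x c∈Fq) (cong (c *_) (e x))))

  IsEnd-· : ∀ {f g} → IsEnd f → IsEnd g → IsEnd (f · g)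
  IsEnd-· {g = g} (add , lin) (add′ , lin′) =
    (λ x y → trans (cong g (add x y)) (add′ _ _)) ,
    (λ c x c∈Fq → trans (cong g (lin c x c∈Fq)) (lin′ c _ c∈Fq))

  IsEnd-⊕ : ∀ {f g} → IsEnd f → IsEnd g → IsEnd (f ⊕ g)
  IsEnd-⊕ (add , lin) (add′ , lin′) =
    (λ x y → trans (cong₂ _+_ (add x y) (add′ x y)) (+-interchange _ _ _ _)) ,
    (λ c x c∈Fq → trans (cong₂ _+_ (lin c x c∈Fq) (lin′ c x c∈Fq)) (sym (distribˡ c _ _)))

  IsEnd-ρ : ∀ a → IsEnd (ρ a)
  IsEnd-ρ a = distribˡ a , λ c x _ → *-leftSwap a c x

  IsEnd-zero : IsEnd zeroE
  IsEnd-zero = (λ _ _ → sym (+-identityˡ 0#)) , (λ c _ _ → sym (zeroʳ c))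

  IsEnd-id : IsEnd idE
  IsEnd-id = (λ _ _ → refl) , (λ _ _ _ → refl)

  EntriesInE-⊗ : ∀ {A B} → EntriesInE A → EntriesInE B → EntriesInE (A ⊗ B)
  EntriesInE-⊗ (a₁₁ , a₁₂ , a₂₁ , a₂₂) (b₁₁ , b₁₂ , b₂₁ , b₂₂) =
    IsEnd-⊕ (IsEnd-· a₁₁ b₁₁) (IsEnd-· a₁₂ b₂₁) , IsEnd-⊕ (IsEnd-· a₁₁ b₁₂) (IsEnd-· a₁₂ b₂₂) ,
    IsEnd-⊕ (IsEnd-· a₂₁ b₁₁) (IsEnd-· a₂₂ b₂₁) , IsEnd-⊕ (IsEnd-· a₂₁ b₁₂) (IsEnd-· a₂₂ b₂₂)

  EntriesInE-resp : ∀ {A B} → A ≈M B → EntriesInE A → EntriesInE B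
  EntriesInE-resp (e₁ , e₂ , e₃ , e₄) (a₁₁ , a₁₂ , a₂₁ , a₂₂) =
    IsEnd-resp e₁ a₁₁ , IsEnd-resp e₂ a₁₂ , IsEnd-resp e₃ a₂₁ , IsEnd-resp e₄ a₂₂

  IsUnit-id : IsUnit idE
  IsUnit-id = IsEnd-id , idE , IsEnd-id , ≈-refl , ≈-refl

  IsUnit-· : ∀ {γ δ} → IsUnit γ → IsUnit δ → IsUnit (γ · δ)
  IsUnit-· {γ} {δ} (eγ , γ′ , eγ′ , γγ′ , γ′γ) (eδ , δ′ , eδ′ , δδ′ , δ′δ) =
    IsEnd-· eγ eδ , δ′ · γ′ , IsEnd-· eδ′ eγ′ ,
    (λ x → trans (cong γ′ (δδ′ (γ x))) (γγ′ x)) ,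
    (λ x → trans (cong δ (γ′γ (δ′ x))) (δ′δ x))

  IsUnit-ρ : ∀ {h} → h ≢ 0# → IsUnit (ρ h)
  IsUnit-ρ {h} h≢0 with inverse h h≢0
  ... | h⁻¹ , hh⁻¹≡1 = IsEnd-ρ h , ρ h⁻¹ , IsEnd-ρ h⁻¹ ,
    (λ x → trans (sym (*-assoc h⁻¹ h x))
                 (trans (cong (_* x) (trans (*-comm h⁻¹ h) hh⁻¹≡1)) (*-identityˡ x))) ,
    (λ x → trans (sym (*-assoc h h⁻¹ x)) (trans (cong (_* x) hh⁻¹≡1) (*-identityˡ x)))

  AreInverse : Mat → Mat → Set
  AreInverse M M′ = EntriesInE M × EntriesInE M′ × (M ⊗ M′) ≈M I₂ × (M′ ⊗ M) ≈M I₂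

  AreInverse-sym : ∀ {M M′} → AreInverse M M′ → AreInverse M′ M
  AreInverse-sym (eM , eM′ , r , l) = eM′ , eM , l , r

  AreInverse⇒IsGL : ∀ {M M′} → AreInverse M M′ → IsGL M
  AreInverse⇒IsGL {M′ = M′} (eM , eM′ , r , l) = eM , M′ , eM′ , r , l

  ▸-cancel : ∀ {M M′} → AreInverse M M′ → ∀ P → ((P ▸ M) ▸ M′) ≈P P
  ▸-cancel {M} {M′} (_ , eM′ , r , _) P = begin
    (P ▸ M) ▸ M′  ≈⟨ ▸-assoc P M eM′ ⟩
    P ▸ (M ⊗ M′)  ≈⟨ ▸-cong (≈P-refl {P}) r ⟩
    P ▸ I₂        ≈⟨ ▸-identityʳ P ⟩
    P             ∎
    where open SetoidReasoning Pair-setoid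

  IsGL-resp : ∀ {A B} → A ≈M B → IsGL A → IsGL B
  IsGL-resp A≈B (eA , N , eN , r , l) =
    EntriesInE-resp A≈B eA , N , eN ,
    ≈M-trans (⊗-cong (≈M-sym A≈B) (≈M-refl {N})) r ,
    ≈M-trans (⊗-cong (≈M-refl {N}) (≈M-sym A≈B)) l

  ⊗-inverse : ∀ {A A′ B B′} → EntriesInE A′ → EntriesInE B′ →
    (A ⊗ A′) ≈M I₂ → (B ⊗ B′) ≈M I₂ → ((A ⊗ B) ⊗ (B′ ⊗ A′)) ≈M I₂
  ⊗-inverse {A} {A′} {B} {B′} eA′ eB′ AA′ BB′ = begin
    (A ⊗ B) ⊗ (B′ ⊗ A′)   ≈⟨ ⊗-assoc A B (EntriesInE-⊗ eB′ eA′) ⟩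
    A ⊗ (B ⊗ (B′ ⊗ A′))   ≈⟨ ⊗-cong (≈M-refl {A}) (⊗-assoc B B′ eA′) ⟨
    A ⊗ ((B ⊗ B′) ⊗ A′)   ≈⟨ ⊗-cong (≈M-refl {A}) (⊗-cong BB′ (≈M-refl {A′})) ⟩
    A ⊗ (I₂ ⊗ A′)         ≈⟨ ⊗-cong (≈M-refl {A}) (⊗-identityˡ eA′) ⟩
    A ⊗ A′                ≈⟨ AA′ ⟩
    I₂                    ∎
    where open SetoidReasoning Mat-setoid

  IsGL-⊗ : ∀ {A B} → IsGL A → IsGL B → IsGL (A ⊗ B)
  IsGL-⊗ (eA , A′ , eA′ , AA′ , A′A) (eB , B′ , eB′ , BB′ , B′B) =
    EntriesInE-⊗ eA eB , B′ ⊗ A′ , EntriesInE-⊗ eB′ eA′ ,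
    ⊗-inverse eA′ eB′ AA′ BB′ , ⊗-inverse eB eA B′B A′A

  diag : Fn → Fn → Mat
  diag γ δ = mat γ zeroE zeroE δ

  scalar : Carrier → Mat
  scalar c = diag (ρ c) (ρ c)

  EntriesInE-scalar : ∀ c → EntriesInE (scalar c)
  EntriesInE-scalar c = IsEnd-ρ c , IsEnd-zero , IsEnd-zero , IsEnd-ρ c

  diag-inverse : ∀ {γ γ′ δ δ′} → Additive γ′ → Additive δ′ → (γ · γ′) ≈ idE → (δ · δ′) ≈ idE →
    (diag γ δ ⊗ diag γ′ δ′) ≈M I₂
  diag-inverse add-γ′ add-δ′ γγ′ δδ′ =
    (λ x → trans (+-identityʳ _) (γγ′ x)) ,
    (λ _ → trans (cong (0# +_) (additive⇒0↦0 add-δ′)) (+-identityʳ 0#)) ,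
    (λ _ → trans (cong (_+ 0#) (additive⇒0↦0 add-γ′)) (+-identityʳ 0#)) ,
    (λ x → trans (+-identityˡ _) (δδ′ x))

  IsGL-diag : ∀ {γ δ} → IsUnit γ → IsUnit δ → IsGL (diag γ δ)
  IsGL-diag (eγ , γ′ , eγ′ , γγ′ , γ′γ) (eδ , δ′ , eδ′ , δδ′ , δ′δ) =
    (eγ , IsEnd-zero , IsEnd-zero , eδ) , diag γ′ δ′ , (eγ′ , IsEnd-zero , IsEnd-zero , eδ′) ,
    diag-inverse (proj₁ eγ′) (proj₁ eδ′) γγ′ δδ′ , diag-inverse (proj₁ eγ) (proj₁ eδ) γ′γ δ′δ

  IsGL-scalar⇒≢0 : ∀ {c} → IsGL (scalar c) → c ≢ 0#
  IsGL-scalar⇒≢0 {c} (_ , N , (n₁₁ , _ , n₂₁ , _) , r , _) c≡0 = 0≢1 (begin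
    0#                                  ≡⟨ +-identityʳ 0# ⟨
    0# + 0#
      ≡⟨ cong₂ _+_ (additive⇒0*↦0 (proj₁ n₁₁) 1#) (additive⇒0↦0 (proj₁ n₂₁)) ⟨
    m11 N (0# * 1#) + m21 N 0#          ≡⟨ cong (λ c → m11 N (c * 1#) + m21 N 0#) c≡0 ⟨
    m11 N (c * 1#) + m21 N 0#           ≡⟨ proj₁ r 1# ⟩
    1#                                  ∎)
    where open ≡-Reasoning

  ≈P⇒∼ : ∀ {P Q} → P ≈P Q → P ∼ Q
  ≈P⇒∼ e = idE , IsUnit-id , e

  ∼-sym : ∀ {P Q} → P ∼ Q → Q ∼ P
  ∼-sym {Q = Q} (γ , (eγ , δ , eδ , γδ , δγ) , (e₁ , e₂)) =
    δ , (eδ , γ , eγ , δγ , γδ) ,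
    (λ x → trans (cong (fst Q) (sym (δγ x))) (sym (e₁ (δ x)))) ,
    (λ x → trans (cong (snd Q) (sym (δγ x))) (sym (e₂ (δ x))))

  ∼-trans : ∀ {P Q R} → P ∼ Q → Q ∼ R → P ∼ R
  ∼-trans (γ , uγ , (e₁ , e₂)) (δ , uδ , (f₁ , f₂)) =
    γ · δ , IsUnit-· uγ uδ , (λ x → trans (e₁ x) (f₁ (γ x))) , (λ x → trans (e₂ x) (f₂ (γ x)))

  ∼-setoid : Setoid 0ℓ 0ℓ
  ∼-setoid = record
    { Carrier = Pair ; _≈_ = _∼_
    ; isEquivalence = record
      { refl = λ {P} → ≈P⇒∼ (≈P-refl {P})
      ; sym = ∼-sym
      ; trans = λ {P} {Q} {R} → ∼-trans {P} {Q} {R} } }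

  ∼-▸ : ∀ {P Q} N → P ∼ Q → (P ▸ N) ∼ (Q ▸ N)
  ∼-▸ N (γ , uγ , (e₁ , e₂)) = γ , uγ ,
    (λ x → cong₂ _+_ (cong (m11 N) (e₁ x)) (cong (m21 N) (e₂ x))) ,
    (λ x → cong₂ _+_ (cong (m12 N) (e₁ x)) (cong (m22 N) (e₂ x)))

  Distant-▸ : ∀ {P Q N} → Distant P Q → IsGL N → Distant (P ▸ N) (Q ▸ N)
  Distant-▸ = IsGL-⊗

  Distant-respʳ : ∀ {P Q Q′} → Q ≈P Q′ → Distant P Q → Distant P Q′
  Distant-respʳ (e₁ , e₂) = IsGL-resp (≈-refl , ≈-refl , e₁ , e₂)

  -- Changing the representative of the first point is left multiplication by diag(γ, 1).
  Distant-respˡ : ∀ {P P′ Q} → P′ ∼ P → Distant P Q → Distant P′ Q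
  Distant-respˡ {P} {P′} {Q} (γ , uγ , (e₁ , e₂)) PQ@((_ , _ , q₁ , q₂) , _) =
    IsGL-resp diag⊗rows≈rows (IsGL-⊗ (IsGL-diag uγ IsUnit-id) PQ)
    where
    diag⊗rows≈rows : (diag γ idE ⊗ rows P Q) ≈M rows P′ Q
    diag⊗rows≈rows =
      (λ x → trans (cong (_ +_) (additive⇒0↦0 (proj₁ q₁))) (trans (+-identityʳ _) (sym (e₁ x)))) ,
      (λ x → trans (cong (_ +_) (additive⇒0↦0 (proj₁ q₂))) (trans (+-identityʳ _) (sym (e₂ x)))) ,
      (λ _ → trans (cong (_+ _) (additive⇒0↦0 (proj₁ (proj₁ (proj₁ PQ))))) (+-identityˡ _)) ,
      (λ _ → trans (cong (_+ _) (additive⇒0↦0 (proj₁ (proj₁ (proj₂ (proj₁ PQ)))))) (+-identityˡ _))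

  Admissible-▸ : ∀ {P N} → Admissible P → IsGL N → Admissible (P ▸ N)
  Admissible-▸ {N = N} (N₀ , gN₀ , e₁ , e₂) gN =
    N₀ ⊗ N , IsGL-⊗ gN₀ gN ,
    ·⊕·-cong {g′ = m11 N} {k′ = m21 N} e₁ ≈-refl e₂ ≈-refl ,
    ·⊕·-cong {g′ = m12 N} {k′ = m22 N} e₁ ≈-refl e₂ ≈-refl

  IsGL-I₂ : IsGL I₂
  IsGL-I₂ = AreInverse⇒IsGL (entries , entries , ⊗-identityʳ I₂ , ⊗-identityʳ I₂)
    where entries = IsEnd-id , IsEnd-zero , IsEnd-zero , IsEnd-id

  Admissible-ρ1ρ0 : Admissible ⟨ ρ 1# , ρ 0# ⟩
  Admissible-ρ1ρ0 = I₂ , IsGL-I₂ , (λ x → sym (*-identityˡ x)) , (λ x → sym (zeroˡ x))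

  -- (a, 1) is the first row of [[a, 1], [1, 0]], whose inverse is [[0, 1], [1, -a]].
  Admissible-ρaρ1 : ∀ a → Admissible ⟨ ρ a , ρ 1# ⟩
  Admissible-ρaρ1 a =
    N , AreInverse⇒IsGL (eN , eN′ , NN′ , N′N) , ≈-refl , (λ x → sym (*-identityˡ x))
    where
    N N′ : Mat
    N = mat (ρ a) idE idE zeroE
    N′ = mat zeroE idE idE (ρ (- a))
    eN = IsEnd-ρ a , IsEnd-id , IsEnd-id , IsEnd-zero
    eN′ = IsEnd-zero , IsEnd-id , IsEnd-id , IsEnd-ρ (- a)
    ax-ax≡0 : ∀ x → a * x + (- a) * x ≡ 0#
    ax-ax≡0 x = trans (sym (distribʳ x a (- a))) (trans (cong (_* x) (-‿inverseʳ a)) (zeroˡ x))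
    NN′ : (N ⊗ N′) ≈M I₂
    NN′ = (λ _ → +-identityˡ _) , ax-ax≡0 , (λ _ → +-identityʳ 0#) ,
          (λ x → trans (cong (x +_) (zeroʳ (- a))) (+-identityʳ x))
    N′N : (N′ ⊗ N) ≈M I₂
    N′N = (λ x → trans (cong (_+ x) (zeroʳ a)) (+-identityˡ x)) , (λ _ → +-identityʳ 0#) ,
          ax-ax≡0 , +-identityʳ

  PGF-resp : ∀ {P P′} → P′ ∼ P → PGF P → PGF P′
  PGF-resp {P} {P′} P′∼P (a , b , ab≢0 , P∼ab) =
    a , b , ab≢0 , ∼-trans {P′} {P} {⟨ ρ a , ρ b ⟩} P′∼P P∼ab

  PGF-ρ1ρ0 : PGF ⟨ ρ 1# , ρ 0# ⟩
  PGF-ρ1ρ0 = 1# , 0# , (λ (1≡0 , _) → 0≢1 (sym 1≡0)) , ≈P⇒∼ ≈P-refl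

  PGF-ρaρ1 : ∀ a → PGF ⟨ ρ a , ρ 1# ⟩
  PGF-ρaρ1 a = a , 1# , (λ (_ , 1≡0) → 0≢1 (sym 1≡0)) , ≈P⇒∼ ≈P-refl

  PreservesPGF : Mat → Set
  PreservesPGF N = ∀ P → Admissible P → PGF P → PGF (P ▸ N)

  Fixes : Mat → Pair → Set
  Fixes D P = (P ▸ D) ∼ P

  -- ρ_c ρ_h = ρ_h ρ_c in the commutative field: the unit ρ_h rescales (ρ_c, ρ_d).
  scalar-fixes-PGF : ∀ {h P} → h ≢ 0# → PGF P → Fixes (scalar h) P
  scalar-fixes-PGF {h} {P} h≢0 (c , d , _ , P∼cd) = begin
    P ▸ scalar h                ≈⟨ ∼-▸ {P} {⟨ ρ c , ρ d ⟩} (scalar h) P∼cd ⟩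
    ⟨ ρ c , ρ d ⟩ ▸ scalar h    ≈⟨ fixes-cd ⟩
    ⟨ ρ c , ρ d ⟩               ≈⟨ ∼-sym {P} {⟨ ρ c , ρ d ⟩} P∼cd ⟩
    P                           ∎
    where
    open SetoidReasoning ∼-setoid
    fixes-cd : Fixes (scalar h) ⟨ ρ c , ρ d ⟩
    fixes-cd = ρ h , IsUnit-ρ h≢0 ,
      (λ x → trans (+-identityʳ _) (*-leftSwap h c x)) ,
      (λ x → trans (+-identityˡ _) (*-leftSwap h d x))

  -- A matrix fixing (1,0) and every (a,1) is scalar: (1,0) forces d₁₂ = 0, (0,1)
  -- forces d₂₁ = 0, and (a,1) then gives d₁₁(a x) = a d₂₂(x).
  fixes-frame⇒scalar : ∀ {D} → EntriesInE D → Fixes D ⟨ ρ 1# , ρ 0# ⟩ →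
    (∀ a → Fixes D ⟨ ρ a , ρ 1# ⟩) → D ≈M scalar (m11 D 1#)
  fixes-frame⇒scalar {mat d₁₁ d₁₂ d₂₁ d₂₂} ((add₁₁ , _) , _ , _ , (add₂₂ , _)) fix₁₀ fix₁ =
    d₁₁≈ρc , d₁₂≈0 , d₂₁≈0 , λ x → trans (sym (d₁₁≈d₂₂ x)) (d₁₁≈ρc x)
    where
    open ≡-Reasoning
    γ : Carrier → Fn
    γ a = proj₁ (fix₁ a)
    d₁₂≈0 : d₁₂ ≈ zeroE
    d₁₂≈0 x = begin
      d₁₂ x                           ≡⟨ cong d₁₂ (*-identityˡ x) ⟨
      d₁₂ (1# * x)                    ≡⟨ +-identityʳ _ ⟨
      d₁₂ (1# * x) + 0#               ≡⟨ cong (_ +_) (additive⇒0*↦0 add₂₂ x) ⟨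
      d₁₂ (1# * x) + d₂₂ (0# * x)     ≡⟨ proj₂ (proj₂ (proj₂ fix₁₀)) x ⟩
      0# * proj₁ fix₁₀ x              ≡⟨ zeroˡ _ ⟩
      0#                              ∎
    d₂₁≈0 : d₂₁ ≈ zeroE
    d₂₁≈0 x = begin
      d₂₁ x                           ≡⟨ cong d₂₁ (*-identityˡ x) ⟨
      d₂₁ (1# * x)                    ≡⟨ +-identityˡ _ ⟨
      0# + d₂₁ (1# * x)               ≡⟨ cong (_+ _) (additive⇒0*↦0 add₁₁ x) ⟨
      d₁₁ (0# * x) + d₂₁ (1# * x)     ≡⟨ proj₁ (proj₂ (proj₂ (fix₁ 0#))) x ⟩
      0# * γ 0# x                     ≡⟨ zeroˡ _ ⟩
      0#                              ∎
    d₂₂≈γ : ∀ a x → d₂₂ x ≡ γ a x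
    d₂₂≈γ a x = begin
      d₂₂ x                           ≡⟨ cong d₂₂ (*-identityˡ x) ⟨
      d₂₂ (1# * x)                    ≡⟨ +-identityˡ _ ⟨
      0# + d₂₂ (1# * x)               ≡⟨ cong (_+ _) (d₁₂≈0 (a * x)) ⟨
      d₁₂ (a * x) + d₂₂ (1# * x)      ≡⟨ proj₂ (proj₂ (proj₂ (fix₁ a))) x ⟩
      1# * γ a x                      ≡⟨ *-identityˡ _ ⟩
      γ a x                           ∎
    d₁₁-semilinear : ∀ a x → d₁₁ (a * x) ≡ a * d₂₂ x
    d₁₁-semilinear a x = begin
      d₁₁ (a * x)                     ≡⟨ +-identityʳ _ ⟨
      d₁₁ (a * x) + 0#                ≡⟨ cong (_ +_) (d₂₁≈0 (1# * x)) ⟨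
      d₁₁ (a * x) + d₂₁ (1# * x)      ≡⟨ proj₁ (proj₂ (proj₂ (fix₁ a))) x ⟩
      a * γ a x                       ≡⟨ cong (a *_) (d₂₂≈γ a x) ⟨
      a * d₂₂ x                       ∎
    d₁₁≈d₂₂ : d₁₁ ≈ d₂₂
    d₁₁≈d₂₂ x = trans (cong d₁₁ (sym (*-identityˡ x))) (trans (d₁₁-semilinear 1# x) (*-identityˡ _))
    d₁₁≈ρc : d₁₁ ≈ ρ (d₁₁ 1#)
    d₁₁≈ρc x = begin
      d₁₁ x                           ≡⟨ cong d₁₁ (*-identityʳ x) ⟨
      d₁₁ (x * 1#)                    ≡⟨ d₁₁-semilinear x 1# ⟩
      x * d₂₂ 1#                      ≡⟨ cong (x *_) (d₁₁≈d₂₂ 1#) ⟨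
      x * d₁₁ 1#                      ≡⟨ *-comm x _ ⟩
      d₁₁ 1# * x                      ∎

  conjugate-scalar : ∀ {N N′ h} → AreInverse N N′ → PreservesPGF N → h ≢ 0# →
    Σ Carrier λ c → c ≢ 0# × ((N ⊗ scalar h) ⊗ N′) ≈M scalar c
  conjugate-scalar {N} {N′} {h} inv@(_ , eN′ , _ , _) preserves h≢0 =
    c , IsGL-scalar⇒≢0 (IsGL-resp D≈c gD) , D≈c
    where
    D : Mat
    D = (N ⊗ scalar h) ⊗ N′
    gD : IsGL D
    gD = IsGL-⊗ (IsGL-⊗ (AreInverse⇒IsGL inv) (IsGL-diag (IsUnit-ρ h≢0) (IsUnit-ρ h≢0)))
                (AreInverse⇒IsGL (AreInverse-sym inv))
    fixes-PGF : ∀ P → Admissible P → PGF P → Fixes D P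
    fixes-PGF P aP pP = begin
      P ▸ D                           ≈⟨ ≈P⇒∼ (▸-assoc₃ P N (EntriesInE-scalar h) eN′) ⟨
      ((P ▸ N) ▸ scalar h) ▸ N′
        ≈⟨ ∼-▸ {(P ▸ N) ▸ scalar h} {P ▸ N} N′ (scalar-fixes-PGF h≢0 (preserves P aP pP)) ⟩
      (P ▸ N) ▸ N′                    ≈⟨ ≈P⇒∼ (▸-cancel inv P) ⟩
      P                               ∎
      where open SetoidReasoning ∼-setoid
    c : Carrier
    c = m11 D 1#
    D≈c : D ≈M scalar c
    D≈c = fixes-frame⇒scalar (proj₁ gD) (fixes-PGF _ Admissible-ρ1ρ0 PGF-ρ1ρ0)
            (λ a → fixes-PGF _ (Admissible-ρaρ1 a) (PGF-ρaρ1 a))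

  scale≈▸scalar : ∀ P c → scale P c ≈P (P ▸ scalar c)
  scale≈▸scalar _ _ = (λ _ → sym (+-identityʳ _)) , (λ _ → sym (+-identityˡ _))

  scale-cong : ∀ {P Q} h → P ≈P Q → scale P h ≈P scale Q h
  scale-cong h (e₁ , e₂) = (λ x → cong (h *_) (e₁ x)) , (λ x → cong (h *_) (e₂ x))

  scale-conjugate : ∀ {N N′ h c} → EntriesInE N′ → ((N ⊗ scalar h) ⊗ N′) ≈M scalar c →
    ∀ P → (scale (P ▸ N) h ▸ N′) ≈P scale P c
  scale-conjugate {N} {N′} {h} {c} eN′ D≈c P = begin
    scale (P ▸ N) h ▸ N′          ≈⟨ ▸-cong (scale≈▸scalar (P ▸ N) h) (≈M-refl {N′}) ⟩
    ((P ▸ N) ▸ scalar h) ▸ N′     ≈⟨ ▸-assoc₃ P N (EntriesInE-scalar h) eN′ ⟩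
    P ▸ ((N ⊗ scalar h) ⊗ N′)     ≈⟨ ▸-cong (≈P-refl {P}) D≈c ⟩
    P ▸ scalar c                  ≈⟨ scale≈▸scalar P c ⟨
    scale P c                     ∎
    where open SetoidReasoning Pair-setoid

  RespectsPoints : PSet → Set
  RespectsPoints S = ∀ {P P′} → P′ ∼ P → S P → S P′

  image⇔▸inverse : ∀ {M M′ S} → AreInverse M M′ → RespectsPoints S →
    ∀ {P} → Admissible P → image M S P ⇔ S (P ▸ M′)
  image⇔▸inverse {M} {M′} {S} inv resp {P} aP = mk⇔ to from
    where
    to : image M S P → S (P ▸ M′)
    to (Q , _ , SQ , P∼QM) =
      resp (∼-trans {P ▸ M′} {(Q ▸ M) ▸ M′} {Q} (∼-▸ {P} {Q ▸ M} M′ P∼QM) (≈P⇒∼ (▸-cancel inv Q)))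
           SQ
    from : S (P ▸ M′) → image M S P
    from SPM′ = P ▸ M′ , Admissible-▸ aP (AreInverse⇒IsGL (AreInverse-sym inv)) , SPM′ ,
                ≈P⇒∼ (≈P-sym (▸-cancel (AreInverse-sym inv) P))

  L-respects : ∀ T → RespectsPoints (L T)
  L-respects T {P} {P′} P′∼P (pP , P≁T) =
    PGF-resp P′∼P pP , λ P′T → P≁T (Distant-respˡ (∼-sym {P′} {P} P′∼P) P′T)

  L′-respects : ∀ T → RespectsPoints (L′ T)
  L′-respects T {P} {P′} P′∼P (h , h≢0 , P∼Th) = h , h≢0 , ∼-trans {P′} {P} {scale T h} P′∼P P∼Th

  ≐-intro : ∀ {A B} → (∀ P → Admissible P → A P ⇔ B P) → A ≐ B
  ≐-intro A⇔B P aP = Equivalence.to (A⇔B P aP) , Equivalence.from (A⇔B P aP)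

  module Transport {M M′ : Mat} (inv : AreInverse M M′)
                   (PGF⇔ : ∀ {P} → Admissible P → PGF P ⇔ PGF (P ▸ M′)) (T : Pair) where

    inv′ : AreInverse M′ M
    inv′ = AreInverse-sym inv

    preserves : PreservesPGF M
    preserves P aP pP = Equivalence.from (PGF⇔ (Admissible-▸ aP (AreInverse⇒IsGL inv)))
                          (PGF-resp (≈P⇒∼ (▸-cancel inv P)) pP)

    preserves′ : PreservesPGF M′
    preserves′ P aP = Equivalence.to (PGF⇔ aP)

    L-▸⇔ : ∀ {P} → Admissible P → L (T ▸ M) P ⇔ L T (P ▸ M′)
    L-▸⇔ {P} aP = mk⇔
      (λ (pP , P≁TM) → Equivalence.to (PGF⇔ aP) pP ,
        λ PM′T → P≁TM (Distant-respˡ (≈P⇒∼ (≈P-sym (▸-cancel inv′ P)))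
                        (Distant-▸ PM′T (AreInverse⇒IsGL inv))))
      (λ (pPM′ , PM′≁T) → Equivalence.from (PGF⇔ aP) pPM′ ,
        λ P-TM → PM′≁T (Distant-respʳ (▸-cancel inv T)
                         (Distant-▸ P-TM (AreInverse⇒IsGL inv′))))

    L′-▸⇔ : ∀ {P} → L′ (T ▸ M) P ⇔ L′ T (P ▸ M′)
    L′-▸⇔ {P} = mk⇔ to from
      where
      open SetoidReasoning ∼-setoid
      to : L′ (T ▸ M) P → L′ T (P ▸ M′)
      to (h , h≢0 , P∼TMh) =
        let c , c≢0 , D≈c = conjugate-scalar {M} {M′} {h} inv preserves h≢0 in
        c , c≢0 , (begin
          P ▸ M′                        ≈⟨ ∼-▸ {P} {scale (T ▸ M) h} M′ P∼TMh ⟩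
          scale (T ▸ M) h ▸ M′
            ≈⟨ ≈P⇒∼ (scale-conjugate {M} {M′} {h} {c} (proj₁ (proj₂ inv)) D≈c T) ⟩
          scale T c                     ∎)
      from : L′ T (P ▸ M′) → L′ (T ▸ M) P
      from (h , h≢0 , PM′∼Th) =
        let c , c≢0 , D≈c = conjugate-scalar {M′} {M} {h} inv′ preserves′ h≢0 in
        c , c≢0 , (begin
          P                             ≈⟨ ≈P⇒∼ (▸-cancel {M′} {M} inv′ P) ⟨
          (P ▸ M′) ▸ M                  ≈⟨ ∼-▸ {P ▸ M′} {scale T h} M PM′∼Th ⟩
          scale T h ▸ M
            ≈⟨ ≈P⇒∼ (▸-cong (scale-cong h (▸-cancel {M} {M′} inv T)) (≈M-refl {M})) ⟨
          scale ((T ▸ M) ▸ M′) h ▸ M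
            ≈⟨ ≈P⇒∼ (scale-conjugate {M′} {M} {h} {c} (proj₁ inv) D≈c (T ▸ M)) ⟩
          scale (T ▸ M) c               ∎)

proposition13 : (q t : ℕ) → IsPrimePower q → 2 ≤ t →
    (K : FiniteField) → FiniteField.size K ≡ q ^ t →
    (M : Proj.Mat K q) → Proj.IsGL K q M →
    Proj._≐_ K q (Proj.image K q M (Proj.PGF K q)) (Proj.PGF K q) →
    (T : Proj.Pair K q) → Proj.Admissible K q T →
    Proj._≐_ K q (Proj.L K q (Proj._▸_ K q T M)) (Proj.image K q M (Proj.L K q T))
    × Proj._≐_ K q (Proj.L′ K q (Proj._▸_ K q T M)) (Proj.image K q M (Proj.L′ K q T))
proposition13 q _ _ _ K _ M (eM , M′ , eM′ , MM′ , M′M) PGF^π≐PGF T _ =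
  ≐-intro (λ _ aP → ⇔-sym (image⇔▸inverse inv (L-respects T) aP) ⇔-∘ L-▸⇔ aP) ,
  ≐-intro (λ _ aP → ⇔-sym (image⇔▸inverse inv (L′-respects T) aP) ⇔-∘ L′-▸⇔)
  where
  open Projective K q
  open Proj K q using (Admissible; PGF; _▸_)
  inv : AreInverse M M′
  inv = eM , eM′ , MM′ , M′M
  PGF⇔ : ∀ {P} → Admissible P → PGF P ⇔ PGF (P ▸ M′)
  PGF⇔ {P} aP = image⇔▸inverse inv PGF-resp aP ⇔-∘
                mk⇔ (proj₂ (PGF^π≐PGF P aP)) (proj₁ (PGF^π≐PGF P aP))
  open Transport inv PGF⇔ T
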